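{- Let $n\geq 2$ and let $a(s,k)$, $1\leq s\neq k\leq n$, be indeterminates. For every map $\sigma:\{1,\ldots,n\}\to\{1,\ldots,n\}$ with $\sigma(s)\neq s$ for all $s$ (so that $\prod_{s=1}^n a(s,\sigma(s))$ is a term in the expansion of $\prod_{s=1}^n\sum_{k\neq s}a(s,k)$), there exist $s<k$ such that $r:=\sigma(k)\leq s$ and $l:=\sigma(s)\geq k$; i.e. the term contains the factor $a(k,r)a(s,l)$ with $1\leq r\leq s<k\leq l\leq n$. -}

module Defs where

-- Since σ has no fixed points, every position j moves up (j < σ j) or down
-- (σ j < j).  The first position moves up and the last one does not, so
-- somewhere two neighbours s and k = s + 1 switch from up to down; then
-- σ k < k gives σ k ≤ s, and s < σ s gives k ≤ σ s.
module Submission where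

open import Defs
open import Data.Nat as ℕ using (ℕ; zero; suc; _≥_)
open import Data.Nat.Properties using (≤⇒≯)
open import Data.Fin using (Fin; zero; suc; inject₁; fromℕ; toℕ; _<_; _≤_)
open import Data.Fin.Properties
  using (<-cmp; _<?_; ≤-refl; ≤fromℕ; ≤̄⇒inject₁<; <⇒≤pred; toℕ-inject₁)
open import Data.Product using (∃; ∃₂; _×_; _,_)
open import Data.Sum using (_⊎_; inj₁; inj₂)
open import Relation.Binary.Definitions using (tri<; tri≈; tri>)
open import Relation.Binary.PropositionalEquality using (_≢_; sym; subst)
open import Relation.Nullary using (¬_; yes; no; contradiction)
open import Relation.Unary using (Pred; Decidable)

adjacent-switch : ∀ {m p} {P : Pred (Fin (suc m)) p} → Decidable P →
  P zero → ¬ P (fromℕ m) → ∃ λ (i : Fin m) → P (inject₁ i) × ¬ P (suc i)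
adjacent-switch {zero}  _  P₀ ¬Pₘ = contradiction P₀ ¬Pₘ
adjacent-switch {suc m} P? P₀ ¬Pₘ with P? (suc zero)
... | no ¬P₁ = zero , P₀ , ¬P₁
... | yes P₁ with adjacent-switch (λ i → P? (suc i)) P₁ ¬Pₘ
...   | i , Pᵢ , ¬Pᵢ₊₁ = suc i , Pᵢ , ¬Pᵢ₊₁

module _ {n} (σ : Fin n → Fin n) (fixed-point-free : ∀ i → σ i ≢ i) where

  moves-up-or-down : ∀ i → i < σ i ⊎ σ i < i
  moves-up-or-down i with <-cmp i (σ i)
  ... | tri< i<σi _ _ = inj₁ i<σi
  ... | tri≈ _ i≡σi _ = contradiction (sym i≡σi) (fixed-point-free i)
  ... | tri> _ _ σi<i = inj₂ σi<i

  moves-down-unless-up : ∀ i → ¬ i < σ i → σ i < i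
  moves-down-unless-up i ¬i<σi with moves-up-or-down i
  ... | inj₁ i<σi = contradiction i<σi ¬i<σi
  ... | inj₂ σi<i = σi<i

lemma4p3 : (n : ℕ) → n ≥ 2 → (σ : Fin n → Fin n) → (∀ s → σ s ≢ s) →
    ∃₂ λ (s k : Fin n) → s < k × σ k ≤ s × k ≤ σ s
lemma4p3 (suc m) _ σ fixed-point-free
  with adjacent-switch (λ i → i <? σ i) first-moves-up last-stays-below
  where
  first-moves-up : zero {m} < σ zero
  first-moves-up with moves-up-or-down σ fixed-point-free zero
  ... | inj₁ 0<σ0 = 0<σ0
  ... | inj₂ ()
  last-stays-below : ¬ fromℕ m < σ (fromℕ m)
  last-stays-below = ≤⇒≯ (≤fromℕ (σ (fromℕ m)))
... | i , s<σs , ¬k<σk =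
  inject₁ i , suc i , ≤̄⇒inject₁< ≤-refl ,
  <⇒≤pred (moves-down-unless-up σ fixed-point-free (suc i) ¬k<σk) ,
  subst (ℕ._< toℕ (σ (inject₁ i))) (toℕ-inject₁ i) s<σs
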